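{- Let $T$ be a hemi-Nelson algebra. For all $x,y\in T$: (1) $1\rightarrow x\le x$; (2) if $x\rightarrow y=1$ then $x=x\wedge(\sim x\vee y)$; (3) if $x\rightarrow y=1$ and $\sim y\rightarrow\sim x=1$ then $x\le y$.
   Context: A Kleene algebra is a bounded distributive lattice $\langle T,\wedge,\vee,0,1\rangle$ with a unary operation $\sim$ such that $\sim\sim x=x$, $\sim(x\wedge y)=\sim x\vee\sim y$ and $(x\wedge\sim x)\wedge(y\vee\sim y)=x\wedge\sim x$. A hemi-Nelson algebra is an algebra $\langle T,\wedge,\vee,\rightarrow,\sim,0,1\rangle$ of type $(2,2,2,1,0,0)$ such that $\langle T,\wedge,\vee,\sim,0,1\rangle$ is a Kleene algebra and for all $x,y,z\in T$: (hN1) $x\rightarrow x=1$; (hN2) $x\wedge(x\rightarrow y)\le x\wedge(\sim x\vee y)$; (hN3) $\sim(x\rightarrow y)\rightarrow(x\wedge\sim y)=1$; (hN4) $(x\wedge\sim y)\rightarrow\sim(x\rightarrow y)=1$; (hN5) $(x\wedge y\wedge(x\rightarrow y))\rightarrow(x\wedge(x\rightarrow y))=1$; (hN6) $(x\wedge(x\rightarrow y))\rightarrow(x\wedge y\wedge(x\rightarrow y))=1$; (hN7) if $x\rightarrow y=1$, $y\rightarrow x=1$, $y\rightarrow z=1$ and $z\rightarrow y=1$ then $x\rightarrow z=1$ and $z\rightarrow x=1$; (hN8) if $x\rightarrow y=1$ and $y\rightarrow x=1$ then $(x\wedge z)\rightarrow(y\wedge z)=1$; (hN9) if $x\rightarrow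 y=1$ and $y\rightarrow x=1$ then $(x\vee z)\rightarrow(y\vee z)=1$; (hN10) if $x\rightarrow y=1$ and $y\rightarrow x=1$ then $(x\rightarrow z)\rightarrow(y\rightarrow z)=1$ and $(z\rightarrow x)\rightarrow(z\rightarrow y)=1$. -}

module Defs where

open import Level using (Level; suc; _⊔_)
open import Relation.Binary.PropositionalEquality using (_≡_)
open import Algebra.Core using (Op₁; Op₂)
open import Data.Product using (_×_)
open import Algebra.Lattice.Structures using (IsDistributiveLattice)

record HemiNelsonAlgebra (a : Level) : Set (suc a) where
  infixr 5 _⇒_
  infixr 6 _∨_
  infixr 7 _∧_
  field
    Carrier : Set a
    _∧_ _∨_ _⇒_ : Op₂ Carrier
    ∼_ : Op₁ Carrier
    𝟘 𝟙 : Carrier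
    isDistributiveLattice : IsDistributiveLattice _≡_ _∨_ _∧_
    𝟘-least : ∀ x → 𝟘 ∧ x ≡ 𝟘
    𝟙-greatest : ∀ x → x ∧ 𝟙 ≡ x
    ∼∼ : ∀ x → ∼ (∼ x) ≡ x
    ∼-∧ : ∀ x y → ∼ (x ∧ y) ≡ (∼ x) ∨ (∼ y)
    kleene : ∀ x y → ((x ∧ ∼ x) ∧ (y ∨ ∼ y)) ≡ x ∧ ∼ x
    -- hemi-Nelson axioms ( a ≤ b  written as  a ∧ b ≡ a )
    hN1 : ∀ x → x ⇒ x ≡ 𝟙
    hN2 : ∀ x y → (x ∧ (x ⇒ y)) ∧ (x ∧ (∼ x ∨ y)) ≡ x ∧ (x ⇒ y)
    hN3 : ∀ x y → ∼ (x ⇒ y) ⇒ (x ∧ ∼ y) ≡ 𝟙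
    hN4 : ∀ x y → (x ∧ ∼ y) ⇒ ∼ (x ⇒ y) ≡ 𝟙
    hN5 : ∀ x y → (x ∧ y ∧ (x ⇒ y)) ⇒ (x ∧ (x ⇒ y)) ≡ 𝟙
    hN6 : ∀ x y → (x ∧ (x ⇒ y)) ⇒ (x ∧ y ∧ (x ⇒ y)) ≡ 𝟙
    hN7 : ∀ x y z → x ⇒ y ≡ 𝟙 → y ⇒ x ≡ 𝟙 → y ⇒ z ≡ 𝟙 → z ⇒ y ≡ 𝟙 →
          (x ⇒ z ≡ 𝟙) × (z ⇒ x ≡ 𝟙)
    hN8 : ∀ x y z → x ⇒ y ≡ 𝟙 → y ⇒ x ≡ 𝟙 → (x ∧ z) ⇒ (y ∧ z) ≡ 𝟙
    hN9 : ∀ x y z → x ⇒ y ≡ 𝟙 → y ⇒ x ≡ 𝟙 → (x ∨ z) ⇒ (y ∨ z) ≡ 𝟙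
    hN10 : ∀ x y z → x ⇒ y ≡ 𝟙 → y ⇒ x ≡ 𝟙 →
           ((x ⇒ z) ⇒ (y ⇒ z) ≡ 𝟙) × ((z ⇒ x) ⇒ (z ⇒ y) ≡ 𝟙)

  _≤_ : Carrier → Carrier → Set a
  x ≤ y = x ∧ y ≡ x

{-# OPTIONS --safe #-}
-- By hN2, x ⇒ y ≡ 𝟙 gives x ≤ ∼ x ∨ y; with x = 𝟙 this is part (1) and as an
-- equation it is part (2). Part (3) then holds in any Kleene algebra: from
-- x ≤ ∼ x ∨ y we get x = (x ∧ ∼ x) ∨ (x ∧ y), and the Kleene axiom splits x ∧ ∼ x
-- along y ∨ ∼ y; its ∼ y-part lies below x ∧ ∼ y, which is ≤ y by negating the
-- contrapositive hypothesis ∼ y ≤ y ∨ ∼ x.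
module Submission where

open import Defs
open import Level using (Level; suc; _⊔_)
open import Data.Product using (_×_; _,_)
open import Relation.Binary.PropositionalEquality using (_≡_; sym; cong)
open import Algebra.Core using (Op₁)
open import Algebra.Definitions using (Congruent₁)
open import Algebra.Lattice.Bundles using (DistributiveLattice)
import Algebra.Lattice.Properties.Lattice as LatticeProperties
import Relation.Binary.Lattice as Order
import Relation.Binary.Reasoning.PartialOrder as ≤-Reasoning

module OrderTheoretic {c ℓ} (L : DistributiveLattice c ℓ) where
  open DistributiveLattice L using (lattice)
  open Order.Lattice (LatticeProperties.∨-∧-orderTheoreticLattice lattice) public
    using (poset; _≤_; y≤x∨y; ∨-least; x∧y≤x; x∧y≤y; ∧-greatest)
    renaming (refl to ≤-refl; trans to ≤-trans)

record KleeneAlgebra c ℓ : Set (suc (c ⊔ ℓ)) where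
  infix 8 ∼_
  field
    distributiveLattice : DistributiveLattice c ℓ

  open DistributiveLattice distributiveLattice public

  field
    ∼_ : Op₁ Carrier
    ∼-cong : Congruent₁ _≈_ ∼_
    ∼∼ : ∀ x → ∼ (∼ x) ≈ x
    ∼-∧ : ∀ x y → ∼ (x ∧ y) ≈ ∼ x ∨ ∼ y
    kleene : ∀ x y → (x ∧ ∼ x) ∧ (y ∨ ∼ y) ≈ x ∧ ∼ x

module KleeneProperties {c ℓ} (K : KleeneAlgebra c ℓ) where
  open KleeneAlgebra K
  open OrderTheoretic distributiveLattice
  open ≤-Reasoning poset

  ∼-∨ : ∀ x y → ∼ (x ∨ y) ≈ ∼ x ∧ ∼ y
  ∼-∨ x y = begin-equality
    ∼ (x ∨ y)                ≈⟨ ∼-cong (∨-cong (∼∼ x) (∼∼ y)) ⟨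
    ∼ (∼ (∼ x) ∨ ∼ (∼ y))    ≈⟨ ∼-cong (∼-∧ (∼ x) (∼ y)) ⟨
    ∼ (∼ (∼ x ∧ ∼ y))        ≈⟨ ∼∼ (∼ x ∧ ∼ y) ⟩
    ∼ x ∧ ∼ y                ∎

  ∼-antitone : ∀ {x y} → x ≤ y → ∼ y ≤ ∼ x
  ∼-antitone {x} {y} x≤y = begin
    ∼ y          ≤⟨ y≤x∨y (∼ x) (∼ y) ⟩
    ∼ x ∨ ∼ y    ≈⟨ ∼-∧ x y ⟨
    ∼ (x ∧ y)    ≈⟨ ∼-cong x≤y ⟨
    ∼ x          ∎

  ≤∼∨-contraposable⇒≤ : ∀ {x y} → x ≤ ∼ x ∨ y → ∼ y ≤ ∼ (∼ y) ∨ ∼ x → x ≤ y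
  ≤∼∨-contraposable⇒≤ {x} {y} x≤∼x∨y ∼y≤∼∼y∨∼x = begin
    x                          ≈⟨ x≤∼x∨y ⟩
    x ∧ (∼ x ∨ y)              ≈⟨ ∧-distribˡ-∨ x (∼ x) y ⟩
    x ∧ ∼ x ∨ x ∧ y            ≤⟨ ∨-least x∧∼x≤y (x∧y≤y x y) ⟩
    y                          ∎
    where
    ∼y∧x≤y : ∼ y ∧ x ≤ y
    ∼y∧x≤y = begin
      ∼ y ∧ x                  ≈⟨ ∧-cong (∼∼ (∼ y)) (∼∼ x) ⟨
      ∼ (∼ (∼ y)) ∧ ∼ (∼ x)    ≈⟨ ∼-∨ (∼ (∼ y)) (∼ x) ⟨
      ∼ (∼ (∼ y) ∨ ∼ x)        ≤⟨ ∼-antitone ∼y≤∼∼y∨∼x ⟩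
      ∼ (∼ y)                  ≈⟨ ∼∼ y ⟩
      y                        ∎

    x∧∼x≤y : x ∧ ∼ x ≤ y
    x∧∼x≤y = begin
      x ∧ ∼ x                              ≈⟨ kleene x y ⟨
      (x ∧ ∼ x) ∧ (y ∨ ∼ y)                ≈⟨ ∧-distribˡ-∨ (x ∧ ∼ x) y (∼ y) ⟩
      (x ∧ ∼ x) ∧ y ∨ (x ∧ ∼ x) ∧ ∼ y      ≤⟨ ∨-least (x∧y≤y (x ∧ ∼ x) y) ∧∼y≤y ⟩
      y                                    ∎
      where
      ∧∼y≤y : (x ∧ ∼ x) ∧ ∼ y ≤ y
      ∧∼y≤y = ≤-trans
        (∧-greatest (x∧y≤y (x ∧ ∼ x) (∼ y)) (≤-trans (x∧y≤x (x ∧ ∼ x) (∼ y)) (x∧y≤x x (∼ x))))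
        ∼y∧x≤y

module HemiNelsonProperties {a : Level} (T : HemiNelsonAlgebra a) where
  open HemiNelsonAlgebra T hiding (_≤_)

  distributiveLattice : DistributiveLattice a a
  distributiveLattice = record
    { Carrier = Carrier
    ; _≈_ = _≡_
    ; _∨_ = _∨_
    ; _∧_ = _∧_
    ; isDistributiveLattice = isDistributiveLattice
    }

  kleeneAlgebra : KleeneAlgebra a a
  kleeneAlgebra = record
    { distributiveLattice = distributiveLattice
    ; ∼_ = ∼_
    ; ∼-cong = cong ∼_
    ; ∼∼ = ∼∼
    ; ∼-∧ = ∼-∧
    ; kleene = kleene
    }

  open OrderTheoretic distributiveLattice
  open KleeneProperties kleeneAlgebra
  open ≤-Reasoning poset

  ∧⇒≤∼∨ : ∀ x y → x ∧ (x ⇒ y) ≤ ∼ x ∨ y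
  ∧⇒≤∼∨ x y = begin
    x ∧ (x ⇒ y)                       ≈⟨ hN2 x y ⟨
    (x ∧ (x ⇒ y)) ∧ (x ∧ (∼ x ∨ y))   ≤⟨ x∧y≤y _ _ ⟩
    x ∧ (∼ x ∨ y)                     ≤⟨ x∧y≤y _ _ ⟩
    ∼ x ∨ y                           ∎

  ∼𝟙≤ : ∀ x → ∼ 𝟙 ≤ x
  ∼𝟙≤ x = begin
    ∼ 𝟙        ≤⟨ ∼-antitone (sym (𝟙-greatest (∼ x))) ⟩
    ∼ (∼ x)    ≈⟨ ∼∼ x ⟩
    x          ∎

  𝟙⇒x≤x : ∀ x → 𝟙 ⇒ x ≤ x
  𝟙⇒x≤x x = begin
    𝟙 ⇒ x              ≈⟨ 𝟙-greatest (𝟙 ⇒ x) ⟨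
    (𝟙 ⇒ x) ∧ 𝟙        ≈⟨ ∧-comm (𝟙 ⇒ x) 𝟙 ⟩
    𝟙 ∧ (𝟙 ⇒ x)        ≤⟨ ∧⇒≤∼∨ 𝟙 x ⟩
    ∼ 𝟙 ∨ x            ≤⟨ ∨-least (∼𝟙≤ x) ≤-refl ⟩
    x                  ∎
    where open DistributiveLattice distributiveLattice using (∧-comm)

  ⇒≡𝟙⇒≤∼∨ : ∀ {x y} → x ⇒ y ≡ 𝟙 → x ≤ ∼ x ∨ y
  ⇒≡𝟙⇒≤∼∨ {x} {y} x⇒y≡𝟙 = begin
    x                  ≈⟨ 𝟙-greatest x ⟨
    x ∧ 𝟙              ≈⟨ cong (x ∧_) x⇒y≡𝟙 ⟨
    x ∧ (x ⇒ y)        ≤⟨ ∧⇒≤∼∨ x y ⟩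
    ∼ x ∨ y            ∎

  ⇒≡𝟙⇒≤ : ∀ {x y} → x ⇒ y ≡ 𝟙 → ∼ y ⇒ ∼ x ≡ 𝟙 → x ≤ y
  ⇒≡𝟙⇒≤ x⇒y≡𝟙 ∼y⇒∼x≡𝟙 = ≤∼∨-contraposable⇒≤ (⇒≡𝟙⇒≤∼∨ x⇒y≡𝟙) (⇒≡𝟙⇒≤∼∨ ∼y⇒∼x≡𝟙)

proposition7 : ∀ {a : Level} (T : HemiNelsonAlgebra a) →
    let open HemiNelsonAlgebra T in
    ∀ x y →
      ((𝟙 ⇒ x) ≤ x)
      × (x ⇒ y ≡ 𝟙 → x ≡ x ∧ (∼ x ∨ y))
      × (x ⇒ y ≡ 𝟙 → ∼ y ⇒ ∼ x ≡ 𝟙 → x ≤ y)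
-- The record's x ≤ y is x ∧ y ≡ x, the library's natural order is x ≡ x ∧ y; hence the syms.
proposition7 T x y = sym (𝟙⇒x≤x x) , ⇒≡𝟙⇒≤∼∨ , λ x⇒y≡𝟙 ∼y⇒∼x≡𝟙 → sym (⇒≡𝟙⇒≤ x⇒y≡𝟙 ∼y⇒∼x≡𝟙)
  where open HemiNelsonProperties T
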